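{- Let $p$ be an odd prime and $s$ a positive integer. Let $\mathcal{S}(s)$ be the number of tuples $(x_1,\dots,x_{s+1},y_1,\dots,y_s)$ of integers with $1\le x_i\le p-1$ and $1\le y_i\le p-1$ such that \[ x_1\cdots x_{s+1}\equiv y_1\cdots y_s \pmod p \quad\text{and}\quad \prod_{i=1}^{s}(x_i-1)\equiv \prod_{i=1}^{s}(y_i-1)\pmod p. \] Then \[ \mathcal{S}(s)=\left[(p-1)^s-(p-2)^s\right]^2+(p-1)(p-2)^{2s-2}+\frac{(p-2)^{2s-2}(3-2p)+p-2}{p-1}. \] -}

module Defs where

open import Data.Nat using (ℕ; zero; suc; _∸_; _*_; _+_; _^_)
open import Data.Nat.Divisibility using (_∣_; _∣?_)
open import Data.Integer as ℤ using (ℤ; _⊖_; ∣_∣)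
open import Data.Nat.ListAction using (product)
open import Data.List using (List; []; _∷_; map; concatMap; length; filter; applyUpTo; take)
open import Data.Product using (_×_; _,_)
open import Relation.Nullary.Decidable using (_×-dec_)
open import Data.Rational as ℚ using (ℚ)

_≡_[mod_] : ℕ → ℕ → ℕ → Set
a ≡ b [mod p ] = p ∣ ∣ a ⊖ b ∣

units : ℕ → List ℕ
units p = applyUpTo suc (p ∸ 1)

tuples : ℕ → ℕ → List (List ℕ)
tuples p zero    = [] ∷ []
tuples p (suc k) = concatMap (λ x → map (x ∷_) (tuples p k)) (units p)

candidates : ℕ → ℕ → List (List ℕ × List ℕ)
candidates p s = concatMap (λ x → map (x ,_) (tuples p s)) (tuples p (suc s))

-- the defining conditions of 𝒮(s): product congruence and shifted-product congruence
-- (take s x = (x_1,...,x_s); entries are ≥ 1 so x_i ∸ 1 = x_i - 1)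
Cond : ℕ → ℕ → List ℕ × List ℕ → Set
Cond p s (x , y) =
  (product x ≡ product y [mod p ]) ×
  (product (map (_∸ 1) (take s x)) ≡ product (map (_∸ 1) y) [mod p ])

cond? : ∀ p s t → Relation.Nullary.Decidable.Dec (Cond p s t)
cond? p s (x , y) = (p ∣? _) ×-dec (p ∣? _)

𝒮 : ℕ → ℕ → ℕ
𝒮 p s = length (filter (cond? p s) (candidates p s))

-- exact rational division by a natural number (division by 0 returns 0; irrelevant here since p - 1 ≥ 2)
_/ℕ_ : ℤ → ℕ → ℚ
n /ℕ zero  = ℚ.0ℚ
n /ℕ suc d = n ℚ./ suc d

rhs : ℕ → ℕ → ℚ
rhs p s =
  ℚ._+_ (ℚ._+_ ((ℤ._^_ ((p ∸ 1) ^ s ⊖ (p ∸ 2) ^ s) 2 ℚ./ 1))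
               ((ℤ.+ ((p ∸ 1) * (p ∸ 2) ^ (2 * s ∸ 2))) ℚ./ 1))
        (ℤ._+_ (ℤ._*_ (ℤ.+ ((p ∸ 2) ^ (2 * s ∸ 2))) (3 ⊖ (2 * p))) (ℤ.+ (p ∸ 2)) /ℕ (p ∸ 1))

module Submission where

-- Write Q(t) = ∏ (tᵢ - 1) for a tuple t of units mod p, and N_s(c) for the number of s-tuples t
-- with Q(t) ≡ c. Once x₁,…,x_s and y are fixed, the product congruence determines x_{s+1}, because
-- x₁⋯x_s is a unit; so 𝒮(s) counts the pairs (t, y) of s-tuples with Q(t) ≡ Q(y), that is
-- 𝒮(s) = Σ_c N_s(c)². Exactly Z_s = (p-2)^s tuples have Q(t) ≢ 0, so N_s(0) = (p-1)^s - (p-2)^s.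
-- Splitting off the first entry of a tuple gives N_{s+1}(c) + N_s(-c) = Z_s for c ≢ 0; squaring,
-- summing over the nonzero residues (which c ↦ -c permutes) and using Σ_{c≢0} N_s(c) = Z_s yields
-- K_{s+1} + 2 Z_s² = (p-1) Z_s² + K_s for K_s = Σ_{c≢0} N_s(c)², hence (p-1) K_s = Z_s² + p - 2 by
-- induction; the formula follows from 𝒮(s) = N_s(0)² + K_s.

open import Defs
open import Data.Empty using (⊥-elim)
open import Data.Integer.Base using (_⊖_; ∣_∣)
open import Data.Integer.Properties using (⊖-≥; ∣m⊖n∣≡∣n⊖m∣)
open import Data.List using (List; []; _∷_; _++_; _∷ʳ_; map; concatMap; length; filter; take; applyUpTo; upTo)
open import Data.List.Properties using (length-upTo; upTo-∷ʳ; map-upTo)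
open import Data.List.Relation.Unary.All as All using (All; []; _∷_)
open import Data.List.Relation.Unary.All.Properties as All using (all-upTo; applyUpTo⁺₁)
open import Data.Nat using (ℕ; zero; suc; _+_; _*_; _∸_; _^_; _≤_; _<_; z≤n; s≤s; z<s; _≟_; NonZero; >-nonZero⁻¹; ≢-nonZero)
open import Data.Nat.Coprimality using (coprime-Bézout; prime⇒coprime)
open import Data.Nat.Divisibility using (_∣_; _∣?_; ∣⇒≤; divides; m%n≡0⇒n∣m)
open import Data.Nat.DivMod
  using (_%_; %-distribˡ-+; %-distribˡ-*; m%n%n≡m%n; n%n≡0; m<n⇒m%n≡m; m*n%n≡0; [m+kn]%n≡m%n; %-remove-+ˡ; m≡m%n+[m/n]*n; m%n<n; m%n≤n)
  renaming (_/_ to _div_)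
open import Data.Nat.GCD using (module Bézout)
open import Data.Nat.ListAction using (product)
open import Data.Nat.ListAction.Properties using (product-++)
open import Data.Nat.Primality using (Prime; prime⇒nonZero; euclidsLemma; ¬prime[0]; ¬prime[1])
open import Data.Nat.Properties
open import Data.Nat.Solver using (module +-*-Solver)
open import Data.Product using (_×_; _,_; ∃-syntax)
open import Data.Sum using (_⊎_; inj₁; inj₂)
open import Function using (_∘_; _⇔_; mk⇔; Equivalence)
open import Level using (0ℓ)
open import Relation.Binary.Bundles using (Setoid)
open import Relation.Binary.PropositionalEquality using (_≡_; _≢_; refl; sym; trans; cong; cong₂; module ≡-Reasoning)
import Relation.Binary.Reasoning.Setoid as SetoidReasoning
open import Relation.Nullary using (Dec; yes; no; ¬_; ¬?)
open import Relation.Nullary.Decidable using (_×-dec_)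
open import Relation.Unary using (Pred; Decidable)

∑ : ∀ {a} {A : Set a} → List A → (A → ℕ) → ℕ
∑ []       f = 0
∑ (x ∷ xs) f = f x + ∑ xs f

syntax ∑ xs (λ x → e) = ∑[ x ∈ xs ] e

module _ {a} {A : Set a} where

  ∑-++ : ∀ (xs ys : List A) f → ∑ (xs ++ ys) f ≡ ∑ xs f + ∑ ys f
  ∑-++ []       ys f = refl
  ∑-++ (x ∷ xs) ys f = trans (cong (f x +_) (∑-++ xs ys f)) (sym (+-assoc (f x) _ _))

  ∑-cong : ∀ {f g : A → ℕ} xs → (∀ x → f x ≡ g x) → ∑ xs f ≡ ∑ xs g
  ∑-cong []       f≗g = refl
  ∑-cong (x ∷ xs) f≗g = cong₂ _+_ (f≗g x) (∑-cong xs f≗g)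

  ∑-cong-All : ∀ {f g : A → ℕ} {xs} → All (λ x → f x ≡ g x) xs → ∑ xs f ≡ ∑ xs g
  ∑-cong-All []            = refl
  ∑-cong-All (fx≡gx ∷ eqs) = cong₂ _+_ fx≡gx (∑-cong-All eqs)

  ∑-+ : ∀ xs (f g : A → ℕ) → ∑[ x ∈ xs ] (f x + g x) ≡ ∑ xs f + ∑ xs g
  ∑-+ []       f g = refl
  ∑-+ (x ∷ xs) f g = begin
    f x + g x + ∑[ x ∈ xs ] (f x + g x) ≡⟨ cong (f x + g x +_) (∑-+ xs f g) ⟩
    f x + g x + (∑ xs f + ∑ xs g)       ≡⟨ solve 4 (λ a b c d → a :+ b :+ (c :+ d) := a :+ c :+ (b :+ d)) refl
                                                   (f x) (g x) (∑ xs f) (∑ xs g) ⟩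
    f x + ∑ xs f + (g x + ∑ xs g)       ∎
    where
    open ≡-Reasoning
    open +-*-Solver

  ∑-*ˡ : ∀ xs c (f : A → ℕ) → ∑[ x ∈ xs ] (c * f x) ≡ c * ∑ xs f
  ∑-*ˡ []       c f = sym (*-zeroʳ c)
  ∑-*ˡ (x ∷ xs) c f = trans (cong (c * f x +_) (∑-*ˡ xs c f)) (sym (*-distribˡ-+ c (f x) _))

  ∑-*ʳ : ∀ xs c (f : A → ℕ) → ∑[ x ∈ xs ] (f x * c) ≡ ∑ xs f * c
  ∑-*ʳ []       c f = refl
  ∑-*ʳ (x ∷ xs) c f = trans (cong (f x * c +_) (∑-*ʳ xs c f)) (sym (*-distribʳ-+ c (f x) _))

  ∑-const : ∀ (xs : List A) c → ∑[ _ ∈ xs ] c ≡ length xs * c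
  ∑-const []       c = refl
  ∑-const (x ∷ xs) c = cong (c +_) (∑-const xs c)

module _ {a b} {A : Set a} {B : Set b} where

  ∑-map : ∀ (h : A → B) xs f → ∑ (map h xs) f ≡ ∑[ x ∈ xs ] f (h x)
  ∑-map h []       f = refl
  ∑-map h (x ∷ xs) f = cong (f (h x) +_) (∑-map h xs f)

  ∑-concatMap : ∀ (g : A → List B) xs f → ∑ (concatMap g xs) f ≡ ∑[ x ∈ xs ] ∑ (g x) f
  ∑-concatMap g []       f = refl
  ∑-concatMap g (x ∷ xs) f = trans (∑-++ (g x) (concatMap g xs) f) (cong (∑ (g x) f +_) (∑-concatMap g xs f))

  ∑-comm : ∀ xs ys (f : A → B → ℕ) → ∑[ x ∈ xs ] ∑[ y ∈ ys ] f x y ≡ ∑[ y ∈ ys ] ∑[ x ∈ xs ] f x y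
  ∑-comm []       ys f = sym (trans (∑-const ys 0) (*-zeroʳ (length ys)))
  ∑-comm (x ∷ xs) ys f = trans (cong (∑ ys (f x) +_) (∑-comm xs ys f)) (sym (∑-+ ys (f x) _))

∑-applyUpTo : ∀ (g : ℕ → ℕ) n f → ∑ (applyUpTo g n) f ≡ ∑[ i ∈ upTo n ] f (g i)
∑-applyUpTo g n f = trans (cong (λ xs → ∑ xs f) (sym (map-upTo g n))) (∑-map g (upTo n) f)

∑-upTo-suc : ∀ n f → ∑ (upTo (suc n)) f ≡ ∑ (upTo n) f + f n
∑-upTo-suc n f = begin
  ∑ (upTo (suc n)) f       ≡⟨ cong (λ xs → ∑ xs f) (sym (upTo-∷ʳ n)) ⟩
  ∑ (upTo n ∷ʳ n) f        ≡⟨ ∑-++ (upTo n) _ f ⟩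
  ∑ (upTo n) f + (f n + 0) ≡⟨ cong (∑ (upTo n) f +_) (+-identityʳ (f n)) ⟩
  ∑ (upTo n) f + f n       ∎
  where open ≡-Reasoning

∑-upTo-cong : ∀ n {f g} → (∀ i → i < n → f i ≡ g i) → ∑ (upTo n) f ≡ ∑ (upTo n) g
∑-upTo-cong n f≗g = ∑-cong-All (All.map (f≗g _) (all-upTo n))

∑-upTo-const : ∀ n c → ∑[ _ ∈ upTo n ] c ≡ n * c
∑-upTo-const n c = trans (∑-const (upTo n) c) (cong (_* c) (length-upTo n))

∑-upTo-reverse : ∀ n f → ∑[ j ∈ upTo n ] f (n ∸ suc j) ≡ ∑ (upTo n) f
∑-upTo-reverse zero    f = refl
∑-upTo-reverse (suc n) f = begin
  f n + ∑[ j ∈ applyUpTo suc n ] f (suc n ∸ suc j) ≡⟨ cong (f n +_) (∑-applyUpTo suc n _) ⟩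
  f n + ∑[ j ∈ upTo n ] f (n ∸ suc j)              ≡⟨ cong (f n +_) (∑-upTo-reverse n f) ⟩
  f n + ∑ (upTo n) f                               ≡⟨ +-comm (f n) _ ⟩
  ∑ (upTo n) f + f n                               ≡⟨ sym (∑-upTo-suc n f) ⟩
  ∑ (upTo (suc n)) f                               ∎
  where open ≡-Reasoning

𝟙 : ∀ {a} {A : Set a} → Dec A → ℕ
𝟙 (yes _) = 1
𝟙 (no _)  = 0

𝟙-cong : ∀ {a b} {A : Set a} {B : Set b} → (A → B) → (B → A) → (A? : Dec A) (B? : Dec B) → 𝟙 A? ≡ 𝟙 B?
𝟙-cong f g (yes a) (yes b) = refl
𝟙-cong f g (yes a) (no ¬b) = ⊥-elim (¬b (f a))
𝟙-cong f g (no ¬a) (yes b) = ⊥-elim (¬a (g b))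
𝟙-cong f g (no ¬a) (no ¬b) = refl

𝟙-× : ∀ {a b} {A : Set a} {B : Set b} (A? : Dec A) (B? : Dec B) → 𝟙 (A? ×-dec B?) ≡ 𝟙 A? * 𝟙 B?
𝟙-× (yes _) (yes _) = refl
𝟙-× (yes _) (no _)  = refl
𝟙-× (no _)  (yes _) = refl
𝟙-× (no _)  (no _)  = refl

𝟙-idem : ∀ {a} {A : Set a} (A? : Dec A) → 𝟙 A? * 𝟙 A? ≡ 𝟙 A?
𝟙-idem (yes _) = refl
𝟙-idem (no _)  = refl

length-filter : ∀ {a p} {A : Set a} {P : Pred A p} (P? : Decidable P) xs → length (filter P? xs) ≡ ∑[ x ∈ xs ] 𝟙 (P? x)
length-filter P? []       = refl
length-filter P? (x ∷ xs) with P? x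
... | yes _ = cong suc (length-filter P? xs)
... | no _  = length-filter P? xs

∑-upTo-select : ∀ n {d} (g : ℕ → ℕ) → d < n → ∑[ i ∈ upTo n ] (𝟙 (i ≟ d) * g i) ≡ g d
∑-upTo-select zero    g ()
∑-upTo-select (suc n) {d} g d<1+n = trans (∑-upTo-suc n _) (last (n ≟ d) (m≤n⇒m<n∨m≡n (≤-pred d<1+n)))
  where
  below : ∀ k → k ≤ d → ∑[ i ∈ upTo k ] (𝟙 (i ≟ d) * g i) ≡ 0
  below zero    _   = refl
  below (suc k) k<d = trans (∑-upTo-suc k _) (cong₂ _+_ (below k (<⇒≤ k<d)) (missed (k ≟ d)))
    where
    missed : (k≟d : Dec (k ≡ d)) → 𝟙 k≟d * g k ≡ 0
    missed (yes refl) = ⊥-elim (<-irrefl refl k<d)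
    missed (no _)     = refl
  last : (n≟d : Dec (n ≡ d)) → d < n ⊎ d ≡ n → ∑[ i ∈ upTo n ] (𝟙 (i ≟ d) * g i) + 𝟙 n≟d * g n ≡ g d
  last (yes refl) _          = cong₂ _+_ (below n ≤-refl) (+-identityʳ (g n))
  last (no _)     (inj₁ d<n) = trans (+-identityʳ _) (∑-upTo-select n g d<n)
  last (no n≢d)   (inj₂ d≡n) = ⊥-elim (n≢d (sym d≡n))

square-identity : ∀ x y {z} → x + y ≡ z → x * x + 2 * (z * y) ≡ z * z + y * y
square-identity x y refl = solve 2 (λ x y → x :* x :+ con 2 :* ((x :+ y) :* y) := (x :+ y) :* (x :+ y) :+ y :* y) refl x y
  where open +-*-Solver

module Congruence (n : ℕ) .{{_ : NonZero n}} where

  infix 4 _≈_ _≈?_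

  record _≈_ (a b : ℕ) : Set where
    constructor mod≡
    field %≡% : a % n ≡ b % n
  open _≈_ public

  ≈-refl : ∀ {a} → a ≈ a
  ≈-refl = mod≡ refl

  ≈-sym : ∀ {a b} → a ≈ b → b ≈ a
  ≈-sym (mod≡ e) = mod≡ (sym e)

  ≈-trans : ∀ {a b c} → a ≈ b → b ≈ c → a ≈ c
  ≈-trans (mod≡ e) (mod≡ f) = mod≡ (trans e f)

  ≡⇒≈ : ∀ {a b} → a ≡ b → a ≈ b
  ≡⇒≈ refl = ≈-refl

  ≈-setoid : Setoid 0ℓ 0ℓ
  ≈-setoid = record { _≈_ = _≈_ ; isEquivalence = record { refl = ≈-refl ; sym = ≈-sym ; trans = ≈-trans } }

  module ≈-Reasoning = SetoidReasoning ≈-setoid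

  _≈?_ : ∀ a b → Dec (a ≈ b)
  a ≈? b with a % n ≟ b % n
  ... | yes e = yes (mod≡ e)
  ... | no ¬e = no (¬e ∘ %≡%)

  +-cong : ∀ {a a′ b b′} → a ≈ a′ → b ≈ b′ → a + b ≈ a′ + b′
  +-cong {a} {a′} {b} {b′} (mod≡ e) (mod≡ f) = mod≡ (begin
    (a + b) % n           ≡⟨ %-distribˡ-+ a b n ⟩
    (a % n + b % n) % n   ≡⟨ cong₂ (λ x y → (x + y) % n) e f ⟩
    (a′ % n + b′ % n) % n ≡⟨ sym (%-distribˡ-+ a′ b′ n) ⟩
    (a′ + b′) % n         ∎)
    where open ≡-Reasoning

  *-cong : ∀ {a a′ b b′} → a ≈ a′ → b ≈ b′ → a * b ≈ a′ * b′
  *-cong {a} {a′} {b} {b′} (mod≡ e) (mod≡ f) = mod≡ (begin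
    (a * b) % n             ≡⟨ %-distribˡ-* a b n ⟩
    (a % n * (b % n)) % n   ≡⟨ cong₂ (λ x y → (x * y) % n) e f ⟩
    (a′ % n * (b′ % n)) % n ≡⟨ sym (%-distribˡ-* a′ b′ n) ⟩
    (a′ * b′) % n           ∎)
    where open ≡-Reasoning

  a%n≈a : ∀ a → a % n ≈ a
  a%n≈a a = mod≡ (m%n%n≡m%n a n)

  n≈0 : n ≈ 0
  n≈0 = mod≡ (trans (n%n≡0 n) (sym (m*n%n≡0 0 n)))

  [a+kn]≈a : ∀ a k → a + k * n ≈ a
  [a+kn]≈a a k = mod≡ ([m+kn]%n≡m%n a k n)

  +-inverseʳ : ∀ a → a + (n ∸ a % n) ≈ 0
  +-inverseʳ a = ≈-trans (+-cong (≈-sym (a%n≈a a)) ≈-refl) (≈-trans (≡⇒≈ (m+[n∸m]≡n (m%n≤n a n))) n≈0)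

  +-cancelʳ : ∀ {a b} x → a + x ≈ b + x → a ≈ b
  +-cancelʳ {a} {b} x a+x≈b+x = begin
    a              ≡⟨ sym (+-identityʳ a) ⟩
    a + 0          ≈⟨ +-cong (≈-refl {a}) (≈-sym (+-inverseʳ x)) ⟩
    a + (x + -x)   ≡⟨ sym (+-assoc a x -x) ⟩
    a + x + -x     ≈⟨ +-cong a+x≈b+x (≈-refl { -x}) ⟩
    b + x + -x     ≡⟨ +-assoc b x -x ⟩
    b + (x + -x)   ≈⟨ +-cong (≈-refl {b}) (+-inverseʳ x) ⟩
    b + 0          ≡⟨ +-identityʳ b ⟩
    b              ∎
    where
    open ≈-Reasoning
    -x = n ∸ x % n

  ∣∸⇒≈ : ∀ {a b} → b ≤ a → n ∣ a ∸ b → a ≈ b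
  ∣∸⇒≈ {a} {b} b≤a n∣a∸b = mod≡ (trans (cong (_% n) (sym (m∸n+n≡m b≤a))) (%-remove-+ˡ b n∣a∸b))

  ≈⇒∣∸ : ∀ {a b} → a ≈ b → n ∣ a ∸ b
  ≈⇒∣∸ {a} {b} (mod≡ e) = divides (a div n ∸ b div n) (begin
    a ∸ b                                         ≡⟨ cong₂ _∸_ (m≡m%n+[m/n]*n a n) (m≡m%n+[m/n]*n b n) ⟩
    (a % n + a div n * n) ∸ (b % n + b div n * n) ≡⟨ cong (λ r → (r + a div n * n) ∸ (b % n + b div n * n)) e ⟩
    (b % n + a div n * n) ∸ (b % n + b div n * n) ≡⟨ [m+n]∸[m+o]≡n∸o (b % n) _ _ ⟩
    a div n * n ∸ b div n * n                     ≡⟨ sym (*-distribʳ-∸ n (a div n) (b div n)) ⟩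
    (a div n ∸ b div n) * n                       ∎)
    where open ≡-Reasoning

  ≡[mod]⇔≈ : ∀ a b → (a ≡ b [mod n ]) ⇔ (a ≈ b)
  ≡[mod]⇔≈ a b with ≤-total b a
  ... | inj₁ b≤a rewrite ⊖-≥ b≤a = mk⇔ (∣∸⇒≈ b≤a) ≈⇒∣∸
  ... | inj₂ a≤b rewrite ∣m⊖n∣≡∣n⊖m∣ a b | ⊖-≥ a≤b = mk⇔ (≈-sym ∘ ∣∸⇒≈ a≤b) (≈⇒∣∸ ∘ ≈-sym)

  0<∧<n⇒≉0 : ∀ {a} → 0 < a → a < n → ¬ a ≈ 0
  0<∧<n⇒≉0 {suc a} _ a<n a≈0 = <⇒≱ a<n (∣⇒≤ (≈⇒∣∸ a≈0))

  ≉0⇒%≢0 : ∀ {a} → ¬ a ≈ 0 → a % n ≢ 0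
  ≉0⇒%≢0 {a} a≉0 a%n≡0 = a≉0 (∣∸⇒≈ z≤n (m%n≡0⇒n∣m a n a%n≡0))

  [n∸1]*≈⇔≈n∸ : ∀ a {c} → c ≤ n → ((n ∸ 1) * a ≈ c) ⇔ (a ≈ n ∸ c)
  [n∸1]*≈⇔≈n∸ a {c} c≤n = mk⇔ to from
    where
    open ≈-Reasoning
    [n∸1]*a+a≡n*a : (n ∸ 1) * a + a ≡ n * a
    [n∸1]*a+a≡n*a = trans (cong ((n ∸ 1) * a +_) (sym (*-identityˡ a)))
                          (trans (sym (*-distribʳ-+ a (n ∸ 1) 1)) (cong (_* a) (m∸n+n≡m (>-nonZero⁻¹ n))))
    n*a≈0 : n * a ≈ 0
    n*a≈0 = *-cong n≈0 (≈-refl {a})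
    to : (n ∸ 1) * a ≈ c → a ≈ n ∸ c
    to e = +-cancelʳ c (begin
      a + c           ≈⟨ +-cong (≈-refl {a}) (≈-sym e) ⟩
      a + (n ∸ 1) * a ≡⟨ trans (+-comm a _) [n∸1]*a+a≡n*a ⟩
      n * a           ≈⟨ n*a≈0 ⟩
      0               ≈⟨ ≈-sym n≈0 ⟩
      n               ≡⟨ sym (m∸n+n≡m c≤n) ⟩
      n ∸ c + c       ∎)
    from : a ≈ n ∸ c → (n ∸ 1) * a ≈ c
    from e = +-cancelʳ a (begin
      (n ∸ 1) * a + a ≡⟨ [n∸1]*a+a≡n*a ⟩
      n * a           ≈⟨ n*a≈0 ⟩
      0               ≈⟨ ≈-sym n≈0 ⟩
      n               ≡⟨ sym (m+[n∸m]≡n c≤n) ⟩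
      c + (n ∸ c)     ≈⟨ +-cong (≈-refl {c}) (≈-sym e) ⟩
      c + a           ∎)

  δ : ℕ → ℕ → ℕ
  δ a b = 𝟙 (a ≈? b)

  nz : ℕ → ℕ
  nz a = 𝟙 (¬? (a ≈? 0))

  δ-cong : ∀ {a a′ b b′} → a ≈ a′ → b ≈ b′ → δ a b ≡ δ a′ b′
  δ-cong a≈a′ b≈b′ = 𝟙-cong (λ e → ≈-trans (≈-sym a≈a′) (≈-trans e b≈b′))
                            (λ e → ≈-trans a≈a′ (≈-trans e (≈-sym b≈b′))) _ _

  δ-sym : ∀ a b → δ a b ≡ δ b a
  δ-sym a b = 𝟙-cong ≈-sym ≈-sym _ _

  δ-≉ : ∀ {a b} → ¬ a ≈ b → δ a b ≡ 0
  δ-≉ {a} {b} a≉b with a ≈? b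
  ... | yes a≈b = ⊥-elim (a≉b a≈b)
  ... | no _    = refl

  nz-≈0 : ∀ {a} → a ≈ 0 → nz a ≡ 0
  nz-≈0 {a} a≈0 with a ≈? 0
  ... | yes _  = refl
  ... | no a≉0 = ⊥-elim (a≉0 a≈0)

  nz-≉0 : ∀ {a} → ¬ a ≈ 0 → nz a ≡ 1
  nz-≉0 {a} a≉0 with a ≈? 0
  ... | yes a≈0 = ⊥-elim (a≉0 a≈0)
  ... | no _    = refl

  δ0+nz : ∀ a → δ a 0 + nz a ≡ 1
  δ0+nz a with a ≈? 0
  ... | yes _ = refl
  ... | no _  = refl

  𝟙-≡[mod] : ∀ a b → 𝟙 (n ∣? ∣ a ⊖ b ∣) ≡ δ a b
  𝟙-≡[mod] a b = 𝟙-cong (Equivalence.to (≡[mod]⇔≈ a b)) (Equivalence.from (≡[mod]⇔≈ a b)) _ _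

  ∑-δ-select : ∀ a g → ∑[ c ∈ upTo n ] (δ a c * g c) ≡ g (a % n)
  ∑-δ-select a g = trans (∑-upTo-cong n (λ c c<n → cong (_* g c) (δ≡𝟙≟ c c<n))) (∑-upTo-select n g (m%n<n a n))
    where
    δ≡𝟙≟ : ∀ c → c < n → δ a c ≡ 𝟙 (c ≟ a % n)
    δ≡𝟙≟ c c<n = 𝟙-cong (λ e → trans (sym (m<n⇒m%n≡m c<n)) (sym (%≡% e)))
                        (λ e → mod≡ (sym (trans (cong (_% n) e) (m%n%n≡m%n a n)))) _ _

  ∑-δ : ∀ a → ∑[ c ∈ upTo n ] δ a c ≡ 1
  ∑-δ a = trans (∑-cong (upTo n) (λ c → sym (*-identityʳ (δ a c)))) (∑-δ-select a (λ _ → 1))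

  ∑-δ-δ : ∀ a b → ∑[ c ∈ upTo n ] (δ a c * δ b c) ≡ δ a b
  ∑-δ-δ a b = trans (∑-δ-select a (δ b)) (trans (δ-cong ≈-refl (a%n≈a a)) (δ-sym b a))

  fibre : ∀ {a} {A : Set a} → List A → (A → ℕ) → ℕ → ℕ
  fibre xs f c = ∑[ x ∈ xs ] δ (f x) c

  ∑∑δ≡∑fibre² : ∀ {a} {A : Set a} (xs : List A) f →
                ∑[ x ∈ xs ] ∑[ y ∈ xs ] δ (f x) (f y) ≡ ∑[ c ∈ upTo n ] (fibre xs f c * fibre xs f c)
  ∑∑δ≡∑fibre² xs f = begin
    ∑[ x ∈ xs ] ∑[ y ∈ xs ] δ (f x) (f y)
      ≡⟨ ∑-cong xs (λ x → ∑-cong xs (λ y → sym (∑-δ-δ (f x) (f y)))) ⟩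
    ∑[ x ∈ xs ] ∑[ y ∈ xs ] ∑[ c ∈ upTo n ] (δ (f x) c * δ (f y) c)
      ≡⟨ ∑-cong xs (λ x → ∑-comm xs (upTo n) _) ⟩
    ∑[ x ∈ xs ] ∑[ c ∈ upTo n ] ∑[ y ∈ xs ] (δ (f x) c * δ (f y) c)
      ≡⟨ ∑-cong xs (λ x → ∑-cong (upTo n) (λ c → ∑-*ˡ xs (δ (f x) c) _)) ⟩
    ∑[ x ∈ xs ] ∑[ c ∈ upTo n ] (δ (f x) c * fibre xs f c)
      ≡⟨ ∑-comm xs (upTo n) _ ⟩
    ∑[ c ∈ upTo n ] ∑[ x ∈ xs ] (δ (f x) c * fibre xs f c)
      ≡⟨ ∑-cong (upTo n) (λ c → ∑-*ʳ xs (fibre xs f c) _) ⟩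
    ∑[ c ∈ upTo n ] (fibre xs f c * fibre xs f c)
      ∎
    where open ≡-Reasoning

module PrimeCongruence (p : ℕ) (p-prime : Prime p) where

  instance
    p-nonZero : NonZero p
    p-nonZero = prime⇒nonZero p-prime

  open Congruence p public

  *-≉0 : ∀ {a b} → ¬ a ≈ 0 → ¬ b ≈ 0 → ¬ a * b ≈ 0
  *-≉0 {a} {b} a≉0 b≉0 ab≈0 with euclidsLemma a b p-prime (≈⇒∣∸ ab≈0)
  ... | inj₁ p∣a = a≉0 (∣∸⇒≈ z≤n p∣a)
  ... | inj₂ p∣b = b≉0 (∣∸⇒≈ z≤n p∣b)

  nz-* : ∀ a b → nz (a * b) ≡ nz a * nz b
  nz-* a b with a ≈? 0 | b ≈? 0
  ... | yes a≈0 | _       = nz-≈0 {a * b} (*-cong a≈0 (≈-refl {b}))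
  ... | no _    | yes b≈0 = nz-≈0 {a * b} (≈-trans (*-cong (≈-refl {a}) b≈0) (≡⇒≈ (*-zeroʳ a)))
  ... | no a≉0  | no b≉0  = nz-≉0 (*-≉0 a≉0 b≉0)

  inverse : ∀ {r} → ¬ r ≈ 0 → ∃[ v ] r * v ≈ 1
  inverse {r} r≉0 with coprime-Bézout (prime⇒coprime p-prime {{≢-nonZero (≉0⇒%≢0 r≉0)}} (m%n<n r p))
  ... | Bézout.-+ x y 1+xp≡yr = y , (begin
    r * y     ≈⟨ *-cong (≈-sym (a%n≈a r)) (≈-refl {y}) ⟩
    r % p * y ≡⟨ trans (*-comm (r % p) y) (sym 1+xp≡yr) ⟩
    1 + x * p ≈⟨ [a+kn]≈a 1 x ⟩
    1         ∎)
    where open ≈-Reasoning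
  ... | Bézout.+- x y 1+yr≡xp = (p ∸ 1) * y , +-cancelʳ (1 + u) (begin
    r * ((p ∸ 1) * y) + (1 + u)     ≈⟨ +-cong (*-cong (≈-sym (a%n≈a r)) (≈-refl {(p ∸ 1) * y})) ≈-refl ⟩
    r % p * ((p ∸ 1) * y) + (1 + u) ≡⟨ solve 3 (λ R P y → R :* (P :* y) :+ (con 1 :+ y :* R) := con 1 :+ y :* R :* (P :+ con 1))
                                              refl (r % p) (p ∸ 1) y ⟩
    1 + u * (p ∸ 1 + 1)             ≡⟨ cong (λ k → 1 + u * k) (m∸n+n≡m (>-nonZero⁻¹ p)) ⟩
    1 + u * p                       ≈⟨ [a+kn]≈a 1 u ⟩
    1                               ≈⟨ ≈-sym (+-cong (≈-refl {1}) 1+u≈0) ⟩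
    1 + (1 + u)                     ∎)
    where
    open ≈-Reasoning
    open +-*-Solver
    u = y * (r % p)
    1+u≈0 : 1 + u ≈ 0
    1+u≈0 = ≈-trans (≡⇒≈ 1+yr≡xp) ([a+kn]≈a 0 x)

  ∑-δ-*ʳ : ∀ r {c} → ¬ c ≈ 0 → ∑[ w ∈ upTo p ] δ (w * r) c ≡ nz r
  ∑-δ-*ʳ r {c} c≉0 with r ≈? 0
  ... | yes r≈0 = trans (∑-cong (upTo p) (λ w → δ-≉ (wr≉c w))) (trans (∑-upTo-const p 0) (*-zeroʳ p))
    where
    wr≉c : ∀ w → ¬ w * r ≈ c
    wr≉c w wr≈c = c≉0 (≈-trans (≈-sym wr≈c) (≈-trans (*-cong (≈-refl {w}) r≈0) (≡⇒≈ (*-zeroʳ w))))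
  ... | no r≉0 with inverse r≉0
  ...   | v , rv≈1 = trans (∑-cong (upTo p) (λ w → 𝟙-cong (to w) (from w) _ _)) (∑-δ (c * v))
    where
    open ≈-Reasoning
    to : ∀ w → w * r ≈ c → c * v ≈ w
    to w wr≈c = begin
      c * v       ≈⟨ *-cong (≈-sym wr≈c) (≈-refl {v}) ⟩
      w * r * v   ≡⟨ *-assoc w r v ⟩
      w * (r * v) ≈⟨ *-cong (≈-refl {w}) rv≈1 ⟩
      w * 1       ≡⟨ *-identityʳ w ⟩
      w           ∎
    from : ∀ w → c * v ≈ w → w * r ≈ c
    from w cv≈w = begin
      w * r       ≈⟨ *-cong (≈-sym cv≈w) (≈-refl {r}) ⟩
      c * v * r   ≡⟨ trans (*-assoc c v r) (cong (c *_) (*-comm v r)) ⟩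
      c * (r * v) ≈⟨ *-cong (≈-refl {c}) rv≈1 ⟩
      c * 1       ≡⟨ *-identityʳ c ⟩
      c           ∎

module _ (p : ℕ) where

  ∑-units : ∀ f → ∑ (units p) f ≡ ∑[ i ∈ upTo (p ∸ 1) ] f (suc i)
  ∑-units = ∑-applyUpTo suc (p ∸ 1)

  ∑-tuples-suc : ∀ s f → ∑ (tuples p (suc s)) f ≡ ∑[ x ∈ units p ] ∑[ t ∈ tuples p s ] f (x ∷ t)
  ∑-tuples-suc s f = trans (∑-concatMap (λ x → map (x ∷_) (tuples p s)) (units p) f)
                           (∑-cong (units p) (λ x → ∑-map (x ∷_) (tuples p s) f))

  ∑-tuples-∷ʳ : ∀ s f → ∑ (tuples p (suc s)) f ≡ ∑[ t ∈ tuples p s ] ∑[ u ∈ units p ] f (t ∷ʳ u)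
  ∑-tuples-∷ʳ zero    f = trans (∑-tuples-suc zero f)
                                (trans (∑-cong (units p) (λ x → +-identityʳ (f (x ∷ [])))) (sym (+-identityʳ _)))
  ∑-tuples-∷ʳ (suc s) f = begin
    ∑ (tuples p (suc (suc s))) f
      ≡⟨ ∑-tuples-suc (suc s) f ⟩
    ∑[ x ∈ units p ] ∑[ t ∈ tuples p (suc s) ] f (x ∷ t)
      ≡⟨ ∑-cong (units p) (λ x → ∑-tuples-∷ʳ s (λ t → f (x ∷ t))) ⟩
    ∑[ x ∈ units p ] ∑[ t ∈ tuples p s ] ∑[ u ∈ units p ] f (x ∷ t ∷ʳ u)
      ≡⟨ sym (∑-tuples-suc s (λ t → ∑[ u ∈ units p ] f (t ∷ʳ u))) ⟩
    ∑[ t ∈ tuples p (suc s) ] ∑[ u ∈ units p ] f (t ∷ʳ u)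
      ∎
    where open ≡-Reasoning

  ∑-tuples-1 : ∀ s → ∑[ _ ∈ tuples p s ] 1 ≡ (p ∸ 1) ^ s
  ∑-tuples-1 zero    = refl
  ∑-tuples-1 (suc s) = begin
    ∑[ _ ∈ tuples p (suc s) ] 1            ≡⟨ ∑-tuples-suc s (λ _ → 1) ⟩
    ∑[ _ ∈ units p ] ∑[ _ ∈ tuples p s ] 1 ≡⟨ ∑-cong (units p) (λ _ → ∑-tuples-1 s) ⟩
    ∑[ _ ∈ units p ] ((p ∸ 1) ^ s)         ≡⟨ ∑-units (λ _ → (p ∸ 1) ^ s) ⟩
    ∑[ _ ∈ upTo (p ∸ 1) ] ((p ∸ 1) ^ s)    ≡⟨ ∑-upTo-const (p ∸ 1) _ ⟩
    (p ∸ 1) ^ suc s                        ∎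
    where open ≡-Reasoning

-- The prime is written p = q + 2, so that upTo p reduces to 0 ∷ units p and p ∸ 1 to suc q.
module Counting (q : ℕ) (p-prime : Prime (suc (suc q))) where

  p m : ℕ
  p = suc (suc q)
  m = suc q

  open PrimeCongruence p p-prime

  Q : List ℕ → ℕ
  Q t = product (map (_∸ 1) t)

  N : ℕ → ℕ → ℕ
  N s = fibre (tuples p s) Q

  Z : ℕ → ℕ
  Z s = ∑[ t ∈ tuples p s ] nz (Q t)

  K : ℕ → ℕ
  K s = ∑[ c ∈ units p ] (N s c * N s c)

  ∑-units-cong : ∀ {f g} → (∀ c → 0 < c → c < p → f c ≡ g c) → ∑ (units p) f ≡ ∑ (units p) g
  ∑-units-cong {f} {g} f≗g =
    trans (∑-units p f) (trans (∑-upTo-cong m (λ i i<m → f≗g (suc i) z<s (s≤s i<m))) (sym (∑-units p g)))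

  ∑-units-reflect : ∀ f → ∑[ c ∈ units p ] f (p ∸ c) ≡ ∑ (units p) f
  ∑-units-reflect f = begin
    ∑[ c ∈ units p ] f (p ∸ c)          ≡⟨ ∑-units p _ ⟩
    ∑[ j ∈ upTo m ] f (m ∸ j)           ≡⟨ ∑-upTo-cong m (λ j j<m → cong f (+-∸-assoc 1 (≤-pred j<m))) ⟩
    ∑[ j ∈ upTo m ] f (suc (m ∸ suc j)) ≡⟨ ∑-upTo-reverse m (f ∘ suc) ⟩
    ∑[ j ∈ upTo m ] f (suc j)           ≡⟨ sym (∑-units p f) ⟩
    ∑ (units p) f                       ∎
    where open ≡-Reasoning

  ∑-units-δ : ∀ a → ∑[ c ∈ units p ] δ a c ≡ nz a
  ∑-units-δ a = +-cancelˡ-≡ (δ a 0) _ _ (trans (∑-δ a) (sym (δ0+nz a)))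

  ∑-units-δ-* : ∀ {r c} → ¬ r ≈ 0 → ¬ c ≈ 0 → ∑[ u ∈ units p ] δ (r * u) c ≡ 1
  ∑-units-δ-* {r} {c} r≉0 c≉0 = begin
    ∑[ u ∈ units p ] δ (r * u) c ≡⟨ ∑-cong (units p) (λ u → cong (λ x → δ x c) (*-comm r u)) ⟩
    ∑[ u ∈ units p ] δ (u * r) c ≡⟨ cong (_+ ∑[ u ∈ units p ] δ (u * r) c) (sym (δ-≉ (c≉0 ∘ ≈-sym))) ⟩
    ∑[ w ∈ upTo p ] δ (w * r) c  ≡⟨ ∑-δ-*ʳ r c≉0 ⟩
    nz r                         ≡⟨ nz-≉0 r≉0 ⟩
    1                            ∎
    where open ≡-Reasoning

  Admissible : ℕ → List ℕ → Set
  Admissible s t = length t ≡ s × ¬ product t ≈ 0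

  tuples-admissible : ∀ s → All (Admissible s) (tuples p s)
  tuples-admissible zero    = (refl , 0<∧<n⇒≉0 z<s (s≤s z<s)) ∷ []
  tuples-admissible (suc s) = All.concat⁺ (All.map⁺ (applyUpTo⁺₁ suc m λ i<m →
    All.map⁺ (All.map (λ (len , t≉0) → cong suc len , *-≉0 (0<∧<n⇒≉0 z<s (s≤s i<m)) t≉0) (tuples-admissible s))))

  cond-𝟙 : ∀ {s t} u y → length t ≡ s →
           𝟙 (cond? p s (t ∷ʳ u , y)) ≡ δ (product t * u) (product y) * δ (Q t) (Q y)
  cond-𝟙 {t = t} u y refl =
    trans (𝟙-× (p ∣? ∣ product (t ∷ʳ u) ⊖ product y ∣) (p ∣? ∣ Q (take (length t) (t ∷ʳ u)) ⊖ Q y ∣))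
          (cong₂ _*_ (trans (𝟙-≡[mod] _ _) (cong (λ a → δ a (product y)) product-∷ʳ))
                     (trans (𝟙-≡[mod] _ _) (cong (λ x → δ (Q x) (Q y)) (take-length-∷ʳ t))))
    where
    product-∷ʳ : product (t ∷ʳ u) ≡ product t * u
    product-∷ʳ = trans (product-++ t (u ∷ [])) (cong (product t *_) (*-identityʳ u))
    take-length-∷ʳ : ∀ t → take (length t) (t ∷ʳ u) ≡ t
    take-length-∷ʳ []      = refl
    take-length-∷ʳ (x ∷ t) = cong (x ∷_) (take-length-∷ʳ t)

  last-entry-determined : ∀ s {t} → Admissible s t →
    ∑[ u ∈ units p ] ∑[ y ∈ tuples p s ] 𝟙 (cond? p s (t ∷ʳ u , y)) ≡ ∑[ y ∈ tuples p s ] δ (Q t) (Q y)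
  last-entry-determined s {t} (len , t≉0) = begin
    ∑[ u ∈ units p ] ∑[ y ∈ tuples p s ] 𝟙 (cond? p s (t ∷ʳ u , y))
      ≡⟨ ∑-cong (units p) (λ u → ∑-cong (tuples p s) (λ y → cond-𝟙 u y len)) ⟩
    ∑[ u ∈ units p ] ∑[ y ∈ tuples p s ] (δ (product t * u) (product y) * δ (Q t) (Q y))
      ≡⟨ ∑-comm (units p) (tuples p s) _ ⟩
    ∑[ y ∈ tuples p s ] ∑[ u ∈ units p ] (δ (product t * u) (product y) * δ (Q t) (Q y))
      ≡⟨ ∑-cong (tuples p s) (λ y → ∑-*ʳ (units p) (δ (Q t) (Q y)) (λ u → δ (product t * u) (product y))) ⟩
    ∑[ y ∈ tuples p s ] (∑[ u ∈ units p ] δ (product t * u) (product y) * δ (Q t) (Q y))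
      ≡⟨ ∑-cong-All (All.map (λ {y} (_ , y≉0) → cong (_* δ (Q t) (Q y)) (∑-units-δ-* t≉0 y≉0)) (tuples-admissible s)) ⟩
    ∑[ y ∈ tuples p s ] (1 * δ (Q t) (Q y))
      ≡⟨ ∑-cong (tuples p s) (λ y → *-identityˡ _) ⟩
    ∑[ y ∈ tuples p s ] δ (Q t) (Q y)
      ∎
    where open ≡-Reasoning

  𝒮≡collisions : ∀ s → 𝒮 p s ≡ ∑[ t ∈ tuples p s ] ∑[ y ∈ tuples p s ] δ (Q t) (Q y)
  𝒮≡collisions s = begin
    𝒮 p s
      ≡⟨ length-filter (cond? p s) (candidates p s) ⟩
    ∑[ xy ∈ candidates p s ] 𝟙 (cond? p s xy)
      ≡⟨ ∑-concatMap (λ x → map (x ,_) (tuples p s)) (tuples p (suc s)) (𝟙 ∘ cond? p s) ⟩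
    ∑[ x ∈ tuples p (suc s) ] ∑[ xy ∈ map (x ,_) (tuples p s) ] 𝟙 (cond? p s xy)
      ≡⟨ ∑-cong (tuples p (suc s)) (λ x → ∑-map (x ,_) (tuples p s) (𝟙 ∘ cond? p s)) ⟩
    ∑[ x ∈ tuples p (suc s) ] ∑[ y ∈ tuples p s ] 𝟙 (cond? p s (x , y))
      ≡⟨ ∑-tuples-∷ʳ p s _ ⟩
    ∑[ t ∈ tuples p s ] ∑[ u ∈ units p ] ∑[ y ∈ tuples p s ] 𝟙 (cond? p s (t ∷ʳ u , y))
      ≡⟨ ∑-cong-All (All.map (last-entry-determined s) (tuples-admissible s)) ⟩
    ∑[ t ∈ tuples p s ] ∑[ y ∈ tuples p s ] δ (Q t) (Q y)
      ∎
    where open ≡-Reasoning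

  𝒮≡N0²+K : ∀ s → 𝒮 p s ≡ N s 0 * N s 0 + K s
  𝒮≡N0²+K s = trans (𝒮≡collisions s) (∑∑δ≡∑fibre² (tuples p s) Q)

  N0+Z : ∀ s → N s 0 + Z s ≡ m ^ s
  N0+Z s = begin
    N s 0 + Z s                                ≡⟨ sym (∑-+ (tuples p s) (λ t → δ (Q t) 0) (λ t → nz (Q t))) ⟩
    ∑[ t ∈ tuples p s ] (δ (Q t) 0 + nz (Q t)) ≡⟨ ∑-cong (tuples p s) (λ t → δ0+nz (Q t)) ⟩
    ∑[ t ∈ tuples p s ] 1                      ≡⟨ ∑-tuples-1 p s ⟩
    m ^ s                                      ∎
    where open ≡-Reasoning

  ∑-units-nz-pred : ∑[ x ∈ units p ] nz (x ∸ 1) ≡ q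
  ∑-units-nz-pred = begin
    ∑[ x ∈ units p ] nz (x ∸ 1)          ≡⟨ ∑-units p (λ x → nz (x ∸ 1)) ⟩
    nz 0 + ∑[ i ∈ applyUpTo suc q ] nz i ≡⟨ cong₂ _+_ (nz-≈0 ≈-refl) (∑-applyUpTo suc q nz) ⟩
    ∑[ j ∈ upTo q ] nz (suc j)           ≡⟨ ∑-upTo-cong q (λ j j<q → nz-≉0 (0<∧<n⇒≉0 z<s (s≤s (m<n⇒m<1+n j<q)))) ⟩
    ∑[ j ∈ upTo q ] 1                    ≡⟨ trans (∑-upTo-const q 1) (*-identityʳ q) ⟩
    q                                    ∎
    where open ≡-Reasoning

  Z-suc : ∀ s → Z (suc s) ≡ q * Z s
  Z-suc s = begin
    Z (suc s)
      ≡⟨ ∑-tuples-suc p s _ ⟩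
    ∑[ x ∈ units p ] ∑[ t ∈ tuples p s ] nz ((x ∸ 1) * Q t)
      ≡⟨ ∑-cong (units p) (λ x → ∑-cong (tuples p s) (λ t → nz-* (x ∸ 1) (Q t))) ⟩
    ∑[ x ∈ units p ] ∑[ t ∈ tuples p s ] (nz (x ∸ 1) * nz (Q t))
      ≡⟨ ∑-cong (units p) (λ x → ∑-*ˡ (tuples p s) (nz (x ∸ 1)) _) ⟩
    ∑[ x ∈ units p ] (nz (x ∸ 1) * Z s)
      ≡⟨ ∑-*ʳ (units p) (Z s) (λ x → nz (x ∸ 1)) ⟩
    ∑[ x ∈ units p ] nz (x ∸ 1) * Z s
      ≡⟨ cong (_* Z s) ∑-units-nz-pred ⟩
    q * Z s
      ∎
    where open ≡-Reasoning

  Z≡q^s : ∀ s → Z s ≡ q ^ s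
  Z≡q^s zero    = refl
  Z≡q^s (suc s) = trans (Z-suc s) (cong (q *_) (Z≡q^s s))

  ∑-units-N : ∀ s → ∑ (units p) (N s) ≡ Z s
  ∑-units-N s = trans (∑-comm (units p) (tuples p s) (λ c t → δ (Q t) c)) (∑-cong (tuples p s) (λ t → ∑-units-δ (Q t)))

  -- As i = x₁ - 1 runs over 0, …, p - 2 it misses only p - 1 from a full residue system, over which
  -- i · Q(t) ≡ c has nz (Q t) solutions; the missing term δ ((p - 1) · Q t) c = δ (Q t) (p - c) is N s (p ∸ c).
  N-recurrence : ∀ s {c} → c ≤ p → ¬ c ≈ 0 → N (suc s) c + N s (p ∸ c) ≡ Z s
  N-recurrence s {c} c≤p c≉0 = begin
    N (suc s) c + N s (p ∸ c)
      ≡⟨ cong₂ _+_ N-suc N-neg ⟩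
    ∑[ t ∈ tuples p s ] ∑[ i ∈ upTo m ] δ (i * Q t) c + ∑[ t ∈ tuples p s ] δ (m * Q t) c
      ≡⟨ sym (∑-+ (tuples p s) _ _) ⟩
    ∑[ t ∈ tuples p s ] (∑[ i ∈ upTo m ] δ (i * Q t) c + δ (m * Q t) c)
      ≡⟨ ∑-cong (tuples p s) (λ t → sym (∑-upTo-suc m (λ i → δ (i * Q t) c))) ⟩
    ∑[ t ∈ tuples p s ] ∑[ i ∈ upTo p ] δ (i * Q t) c
      ≡⟨ ∑-cong (tuples p s) (λ t → ∑-δ-*ʳ (Q t) c≉0) ⟩
    Z s
      ∎
    where
    open ≡-Reasoning
    N-suc : N (suc s) c ≡ ∑[ t ∈ tuples p s ] ∑[ i ∈ upTo m ] δ (i * Q t) c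
    N-suc = begin
      N (suc s) c                                              ≡⟨ ∑-tuples-suc p s (λ t → δ (Q t) c) ⟩
      ∑[ x ∈ units p ] ∑[ t ∈ tuples p s ] δ ((x ∸ 1) * Q t) c ≡⟨ ∑-units p _ ⟩
      ∑[ i ∈ upTo m ] ∑[ t ∈ tuples p s ] δ (i * Q t) c        ≡⟨ ∑-comm (upTo m) (tuples p s) (λ i t → δ (i * Q t) c) ⟩
      ∑[ t ∈ tuples p s ] ∑[ i ∈ upTo m ] δ (i * Q t) c        ∎
    N-neg : N s (p ∸ c) ≡ ∑[ t ∈ tuples p s ] δ (m * Q t) c
    N-neg = ∑-cong (tuples p s) (λ t → let open Equivalence ([n∸1]*≈⇔≈n∸ (Q t) c≤p) in 𝟙-cong from to _ _)

  K-recurrence : ∀ s → K (suc s) + 2 * (Z s * Z s) ≡ m * (Z s * Z s) + K s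
  K-recurrence s = begin
    K (suc s) + 2 * (z * z)                                 ≡⟨ cong (λ w → K (suc s) + 2 * (z * w)) (sym ∑Y≡z) ⟩
    K (suc s) + 2 * (z * ∑[ c ∈ units p ] Y c)              ≡⟨ cong (λ w → K (suc s) + 2 * w) (sym (∑-*ˡ (units p) z Y)) ⟩
    K (suc s) + 2 * ∑[ c ∈ units p ] (z * Y c)              ≡⟨ cong (K (suc s) +_) (sym (∑-*ˡ (units p) 2 (λ c → z * Y c))) ⟩
    K (suc s) + ∑[ c ∈ units p ] (2 * (z * Y c))            ≡⟨ sym (∑-+ (units p) (λ c → X c * X c) (λ c → 2 * (z * Y c))) ⟩
    ∑[ c ∈ units p ] (X c * X c + 2 * (z * Y c))            ≡⟨ ∑-units-cong {λ c → X c * X c + 2 * (z * Y c)} {λ c → z * z + Y c * Y c}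
                                                                 (λ c 0<c c<p → square-identity (X c) (Y c)
                                                                   (N-recurrence s (<⇒≤ c<p) (0<∧<n⇒≉0 0<c c<p))) ⟩
    ∑[ c ∈ units p ] (z * z + Y c * Y c)                    ≡⟨ ∑-+ (units p) (λ _ → z * z) (λ c → Y c * Y c) ⟩
    ∑[ _ ∈ units p ] (z * z) + ∑[ c ∈ units p ] (Y c * Y c) ≡⟨ cong₂ _+_ (trans (∑-units p (λ _ → z * z)) (∑-upTo-const m (z * z)))
                                                                       (∑-units-reflect (λ c → N s c * N s c)) ⟩
    m * (z * z) + K s                                       ∎
    where
    open ≡-Reasoning
    z = Z s
    X = N (suc s)
    Y = λ c → N s (p ∸ c)
    ∑Y≡z : ∑[ c ∈ units p ] Y c ≡ z
    ∑Y≡z = trans (∑-units-reflect (N s)) (∑-units-N s)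

  K0≡1 : K 0 ≡ 1
  K0≡1 = begin
    ∑[ c ∈ units p ] ((δ 1 c + 0) * (δ 1 c + 0)) ≡⟨ ∑-cong (units p) (λ c → trans (cong (λ k → k * k) (+-identityʳ (δ 1 c)))
                                                                                 (𝟙-idem (1 ≈? c))) ⟩
    ∑[ c ∈ units p ] δ 1 c                       ≡⟨ ∑-units-δ 1 ⟩
    nz 1                                         ≡⟨ nz-≉0 (0<∧<n⇒≉0 z<s (s≤s z<s)) ⟩
    1                                            ∎
    where open ≡-Reasoning

  m*K : ∀ s → m * K s ≡ Z s * Z s + q
  m*K zero    = trans (cong (m *_) K0≡1) (*-identityʳ m)
  m*K (suc s) = +-cancelʳ-≡ (m * (2 * (z * z))) _ _ (begin
    m * K (suc s) + m * (2 * (z * z))             ≡⟨ sym (*-distribˡ-+ m (K (suc s)) _) ⟩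
    m * (K (suc s) + 2 * (z * z))                 ≡⟨ cong (m *_) (K-recurrence s) ⟩
    m * (m * (z * z) + K s)                       ≡⟨ *-distribˡ-+ m (m * (z * z)) (K s) ⟩
    m * (m * (z * z)) + m * K s                   ≡⟨ cong (m * (m * (z * z)) +_) (m*K s) ⟩
    m * (m * (z * z)) + (z * z + q)               ≡⟨ solve 2 (λ q z → (con 1 :+ q) :* ((con 1 :+ q) :* (z :* z)) :+ (z :* z :+ q)
                                                             := q :* z :* (q :* z) :+ q :+ (con 1 :+ q) :* (con 2 :* (z :* z))) refl q z ⟩
    q * z * (q * z) + q + m * (2 * (z * z))       ≡⟨ cong (λ w → w * w + q + m * (2 * (z * z))) (sym (Z-suc s)) ⟩
    Z (suc s) * Z (suc s) + q + m * (2 * (z * z)) ∎)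
    where
    open ≡-Reasoning
    open +-*-Solver
    z = Z s

  closed-form : ∀ s → m * 𝒮 p s ≡ m * ((m ^ s ∸ q ^ s) * (m ^ s ∸ q ^ s)) + (q ^ s * q ^ s + q)
  closed-form s = begin
    m * 𝒮 p s                                                     ≡⟨ cong (m *_) (𝒮≡N0²+K s) ⟩
    m * (N s 0 * N s 0 + K s)                                     ≡⟨ *-distribˡ-+ m (N s 0 * N s 0) (K s) ⟩
    m * (N s 0 * N s 0) + m * K s                                 ≡⟨ cong (m * (N s 0 * N s 0) +_) (m*K s) ⟩
    m * (N s 0 * N s 0) + (Z s * Z s + q)                         ≡⟨ cong₂ (λ d z → m * (d * d) + (z * z + q)) N0≡m^s∸q^s (Z≡q^s s) ⟩
    m * ((m ^ s ∸ q ^ s) * (m ^ s ∸ q ^ s)) + (q ^ s * q ^ s + q) ∎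
    where
    open ≡-Reasoning
    N0≡m^s∸q^s : N s 0 ≡ m ^ s ∸ q ^ s
    N0≡m^s∸q^s = begin
      N s 0             ≡⟨ sym (m+n∸n≡m (N s 0) (Z s)) ⟩
      N s 0 + Z s ∸ Z s ≡⟨ cong₂ _∸_ (N0+Z s) (Z≡q^s s) ⟩
      m ^ s ∸ q ^ s     ∎

open import Data.Integer as ℤ using (ℤ; +_)
open import Data.Integer.Properties as ℤ using (pos-+; pos-*; m-n≡m⊖n)
open import Data.Integer.Solver using () renaming (module +-*-Solver to ℤ-Solver)
import Data.Rational as ℚ
open import Data.Rational using (_/_)
open import Data.Rational.Properties using (toℚᵘ-injective; toℚᵘ-fromℚᵘ; toℚᵘ-homo-+)
open import Data.Rational.Unnormalised as ℚᵘ using (mkℚᵘ; *≡*)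
import Data.Rational.Unnormalised.Properties as ℚᵘ

fraction-sum : ∀ (a b c e : ℤ) d → a ℤ.* + suc d ≡ (b ℤ.+ c) ℤ.* + suc d ℤ.+ e →
               a / 1 ≡ (b / 1 ℚ.+ c / 1) ℚ.+ e / suc d
fraction-sum a b c e d eq = toℚᵘ-injective (begin
  ℚ.toℚᵘ (a / 1)                                  ≈⟨ toℚᵘ-fromℚᵘ (mkℚᵘ a 0) ⟩
  mkℚᵘ a 0                                        ≈⟨ *≡* cross-multiplied ⟩
  (mkℚᵘ b 0 ℚᵘ.+ mkℚᵘ c 0) ℚᵘ.+ mkℚᵘ e d           ≈⟨ ℚᵘ.≃-sym (ℚᵘ.+-cong b/1+c/1 (toℚᵘ-fromℚᵘ (mkℚᵘ e d))) ⟩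
  ℚ.toℚᵘ (b / 1 ℚ.+ c / 1) ℚᵘ.+ ℚ.toℚᵘ (e / suc d) ≈⟨ ℚᵘ.≃-sym (toℚᵘ-homo-+ (b / 1 ℚ.+ c / 1) (e / suc d)) ⟩
  ℚ.toℚᵘ ((b / 1 ℚ.+ c / 1) ℚ.+ e / suc d)        ∎)
  where
  open ℚᵘ.≃-Reasoning
  open ℤ-Solver
  b/1+c/1 : ℚ.toℚᵘ (b / 1 ℚ.+ c / 1) ℚᵘ.≃ mkℚᵘ b 0 ℚᵘ.+ mkℚᵘ c 0
  b/1+c/1 = ℚᵘ.≃-trans (toℚᵘ-homo-+ (b / 1) (c / 1))
                       (ℚᵘ.+-cong (toℚᵘ-fromℚᵘ (mkℚᵘ b 0)) (toℚᵘ-fromℚᵘ (mkℚᵘ c 0)))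
  cross-multiplied : a ℤ.* + (1 * suc d) ≡ ((b ℤ.* + 1 ℤ.+ c ℤ.* + 1) ℤ.* + suc d ℤ.+ e ℤ.* + 1) ℤ.* + 1
  cross-multiplied = trans (cong (λ k → a ℤ.* + k) (*-identityˡ (suc d))) (trans eq
    (solve 4 (λ b c e D → (b :+ c) :* D :+ e := ((b :* con (+ 1) :+ c :* con (+ 1)) :* D :+ e :* con (+ 1)) :* con (+ 1))
             refl b c e (+ suc d)))

q^[2[1+s]∸2]≡q^s*q^s : ∀ q s → q ^ (2 * suc s ∸ 2) ≡ q ^ s * q ^ s
q^[2[1+s]∸2]≡q^s*q^s q s = trans (cong (λ k → q ^ (k ∸ 2)) (*-distribˡ-+ 2 1 s))
                                 (trans (cong (λ k → q ^ (s + k)) (+-identityʳ s)) (^-distribˡ-+-* q s s))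

-- The numerator identity behind rhs, for p = q + 2: with y = q^s, the terms (p-1) q^{2s-2} and
-- q^{2s-2} (3 - 2p) / (p-1) of rhs add up to (q y)² / (p-1), since (p-1)² + 3 - 2p = q².
rhs-numerator : ∀ q s S →
  suc q * S ≡ suc q * ((suc q ^ suc s ∸ q ^ suc s) * (suc q ^ suc s ∸ q ^ suc s)) + (q ^ suc s * q ^ suc s + q) →
  + S ℤ.* + suc q ≡ ((suc q ^ suc s ⊖ q ^ suc s) ℤ.^ 2 ℤ.+ + (suc q * q ^ (2 * suc s ∸ 2))) ℤ.* + suc q
                    ℤ.+ (+ (q ^ (2 * suc s ∸ 2)) ℤ.* (3 ⊖ 2 * suc (suc q)) ℤ.+ + q)
rhs-numerator q s S closed = begin
  + S ℤ.* + m                                                  ≡⟨ trans (ℤ.*-comm (+ S) (+ m)) (sym (pos-* m S)) ⟩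
  + (m * S)                                                    ≡⟨ cong +_ closed ⟩
  + (m * (d * d) + (q * y * (q * y) + q))                      ≡⟨ cast ⟩
  + m ℤ.* (+ d ℤ.* + d) ℤ.+ (+ q ℤ.* + y ℤ.* (+ q ℤ.* + y) ℤ.+ + q)
    ≡⟨ solve 3 (λ D Y Q → (con (+ 1) :+ Q) :* (D :* D) :+ (Q :* Y :* (Q :* Y) :+ Q)
                          := (D :* (D :* con (+ 1)) :+ (con (+ 1) :+ Q) :* (Y :* Y)) :* (con (+ 1) :+ Q)
                             :+ (Y :* Y :* (con (+ 3) :- con (+ 2) :* (con (+ 2) :+ Q)) :+ Q))
               refl (+ d) (+ y) (+ q) ⟩
  (+ d ℤ.* (+ d ℤ.* + 1) ℤ.+ + m ℤ.* (+ y ℤ.* + y)) ℤ.* + m ℤ.+ (+ y ℤ.* + y ℤ.* (+ 3 ℤ.- + 2 ℤ.* + p) ℤ.+ + q)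
    ≡⟨ sym (cong₂ (λ b e → b ℤ.* + m ℤ.+ e) (cong₂ ℤ._+_ square middle) last) ⟩
  ((m ^ suc s ⊖ q ^ suc s) ℤ.^ 2 ℤ.+ + (m * q ^ (2 * suc s ∸ 2))) ℤ.* + m ℤ.+ (+ (q ^ (2 * suc s ∸ 2)) ℤ.* (3 ⊖ 2 * p) ℤ.+ + q)
    ∎
  where
  open ≡-Reasoning
  open ℤ-Solver
  m = suc q
  p = suc m
  y = q ^ s
  d = m ^ suc s ∸ q ^ suc s
  cast : + (m * (d * d) + (q * y * (q * y) + q)) ≡ + m ℤ.* (+ d ℤ.* + d) ℤ.+ (+ q ℤ.* + y ℤ.* (+ q ℤ.* + y) ℤ.+ + q)
  cast = trans (pos-+ (m * (d * d)) _)
               (cong₂ ℤ._+_ (trans (pos-* m (d * d)) (cong (+ m ℤ.*_) (pos-* d d)))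
                            (trans (pos-+ (q * y * (q * y)) q)
                                   (cong (ℤ._+ + q) (trans (pos-* (q * y) (q * y)) (cong₂ ℤ._*_ (pos-* q y) (pos-* q y))))))
  q^[2s]≡y*y : + (q ^ (2 * suc s ∸ 2)) ≡ + y ℤ.* + y
  q^[2s]≡y*y = trans (cong +_ (q^[2[1+s]∸2]≡q^s*q^s q s)) (pos-* y y)
  square : (m ^ suc s ⊖ q ^ suc s) ℤ.^ 2 ≡ + d ℤ.* (+ d ℤ.* + 1)
  square = cong (λ x → x ℤ.* (x ℤ.* + 1)) (⊖-≥ (^-monoˡ-≤ (suc s) (n≤1+n q)))
  middle : + (m * q ^ (2 * suc s ∸ 2)) ≡ + m ℤ.* (+ y ℤ.* + y)
  middle = trans (pos-* m _) (cong (+ m ℤ.*_) q^[2s]≡y*y)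
  last : + (q ^ (2 * suc s ∸ 2)) ℤ.* (3 ⊖ 2 * p) ℤ.+ + q ≡ + y ℤ.* + y ℤ.* (+ 3 ℤ.- + 2 ℤ.* + p) ℤ.+ + q
  last = cong₂ (λ a b → a ℤ.* b ℤ.+ + q) q^[2s]≡y*y (trans (sym (m-n≡m⊖n 3 (2 * p))) (cong (λ k → + 3 ℤ.- k) (pos-* 2 p)))

rhs-from-closed-form : ∀ q s S →
  suc q * S ≡ suc q * ((suc q ^ suc s ∸ q ^ suc s) * (suc q ^ suc s ∸ q ^ suc s)) + (q ^ suc s * q ^ suc s + q) →
  (+ S) / 1 ≡ rhs (suc (suc q)) (suc s)
rhs-from-closed-form q s S closed =
  fraction-sum (+ S) ((suc q ^ suc s ⊖ q ^ suc s) ℤ.^ 2) (+ (suc q * q ^ (2 * suc s ∸ 2)))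
               (+ (q ^ (2 * suc s ∸ 2)) ℤ.* (3 ⊖ 2 * suc (suc q)) ℤ.+ + q) q (rhs-numerator q s S closed)

lemma4p3 : (p s : ℕ) → Prime p → p ≢ 2 → 1 ≤ s →
  (+ 𝒮 p s) / 1 ≡ rhs p s
lemma4p3 0             _       p-prime _ _  = ⊥-elim (¬prime[0] p-prime)
lemma4p3 1             _       p-prime _ _  = ⊥-elim (¬prime[1] p-prime)
lemma4p3 (suc (suc q)) zero    _       _ ()
lemma4p3 (suc (suc q)) (suc s) p-prime _ _  = rhs-from-closed-form q s _ (Counting.closed-form q p-prime (suc s))
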